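{- Let $(A,V)$ and $(B,W)$ be permutation groups, and let $t\geq 1$ be the number of orbits of $A$. If $I_t\times B\notin GR$ and $B\neq I_2$, then $A\wr B\notin GR$.
   Context: Permutation groups are considered up to permutation isomorphism and act on sets with more than one element. A colored graph is a pair $(V,E)$ with $E$ a function from the unordered pairs of distinct vertices to a set of colors; automorphisms are color-preserving permutations of the vertices. $GR$ is the class of permutation groups that are the automorphism group of some colored graph. $I_n$ denotes the identity group on an $n$-element set. For permutation groups $(A,V)$, $(B,W)$ the direct product $A\times B$ acts on $V\times W$ by $(v,w)(\alpha,\beta)=(v\alpha,w\beta)$; in particular $I_t\times B$ (the parallel multiple of $B$) acts on $\{1,\dots,t\}\times W$ by $(i,w)\mapsto (i,w\beta)$, $\beta\in B$. The (imprimitive) wreath product $A\wr B$ is the permutation group on $V\times W$ of all permutations $\gamma$ for which there are $\alpha_w\in A$ ($w\in W$) and $\beta\in B$ with $(v,w)\gamma=(v\alpha_w,w\beta)$ for all $(v,w)$. -}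

module Defs where

open import Level using (0ℓ)
open import Data.Nat using (ℕ; _≤_)
open import Data.Fin using (Fin)
open import Data.Product using (Σ; Σ-syntax; ∃; ∃-syntax; _×_; _,_)
open import Function using (_↔_; Inverse; Surjective; _⇔_)
open import Function.Construct.Identity using (↔-id)
open import Function.Construct.Composition using (_↔-∘_)
open import Function.Construct.Symmetry using (↔-sym)
open import Relation.Binary.PropositionalEquality using (_≡_)
open import Relation.Nullary using (¬_)

Perm : Set → Set
Perm V = V ↔ V

_·_ : {V : Set} → V → Perm V → V
v · σ = Inverse.to σ v

_≗ₚ_ : {V : Set} → Perm V → Perm V → Set
σ ≗ₚ τ = ∀ v → v · σ ≡ v · τ

record PermGroup : Set₁ where
  field
    V      : Set
    size   : ℕ
    enum   : V ↔ Fin size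
    two≤   : 2 ≤ size
    G      : Perm V → Set
    G-resp : ∀ {σ τ} → σ ≗ₚ τ → G σ → G τ
    G-id   : G (↔-id V)
    G-comp : ∀ {σ τ} → G σ → G τ → G (σ ↔-∘ τ)
    G-inv  : ∀ {σ} → G σ → G (↔-sym σ)

open PermGroup public

-- A colored graph on V with colours in C: E assigns a colour to each
-- unordered pair of distinct vertices (symmetric; diagonal ignored).
record ColoredGraph (V : Set) : Set₁ where
  field
    Color : Set
    E     : V → V → Color
    E-sym : ∀ x y → E x y ≡ E y x

open ColoredGraph public

IsAut : {V : Set} → ColoredGraph V → Perm V → Set
IsAut Γ σ = ∀ x y → ¬ (x ≡ y) → E Γ (x · σ) (y · σ) ≡ E Γ x y

-- A set of permutations of V (given by a predicate) is in GR iff it is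
-- exactly the automorphism group of some coloured graph on V.
InGR : (V : Set) → (Perm V → Set) → Set₁
InGR V H = Σ[ Γ ∈ ColoredGraph V ] (∀ σ → H σ ⇔ IsAut Γ σ)

HasOrbitCount : PermGroup → ℕ → Set
HasOrbitCount A t =
  Σ[ f ∈ (V A → Fin t) ] (Surjective _≡_ _≡_ f ×
    (∀ x y → f x ≡ f y ⇔ (∃[ α ] (G A α × x · α ≡ y))))

-- The parallel multiple I_t × B acting on Fin t × W.
ParMult : (t : ℕ) (B : PermGroup) → Perm (Fin t × V B) → Set
ParMult t B γ = ∃[ β ] (G B β × (∀ i w → (i , w) · γ ≡ (i , w · β)))

Wreath : (A B : PermGroup) → Perm (V A × V B) → Set
Wreath A B γ =
  Σ[ α ∈ (V B → Perm (V A)) ] Σ[ β ∈ Perm (V B) ]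
    ((∀ w → G A (α w)) × G B β ×
     (∀ v w → (v , w) · γ ≡ (v · α w , w · β)))

-- B is (permutation isomorphic to) I_2: acts on 2 points, only identity.
IsI2 : PermGroup → Set
IsI2 B = size B ≡ 2 × (∀ β → G B β → β ≗ₚ ↔-id (V B))

-- Given a coloured graph Γ on V × W with automorphism group A ≀ B, build a coloured graph Δ on
-- Fin t × W with automorphism group I_t × B; the vertex (i , w) stands for the i-th A-orbit in
-- the block V × {w}. An edge of Δ between orbits i < j records i, j, natural-number codes of the
-- local patterns of Γ on the two blocks and the pattern of Γ between them; an edge inside orbit i
-- records i, the unordered pair (min, max) of local codes, and the Γ-colour between a fixed
-- representative of orbit i in the two blocks, which by transitivity of A on the orbit is that
-- of any two of its points in distinct blocks.
--
-- B preserves Γ, hence I_t × B preserves Δ. Conversely an automorphism δ of Δ keeps orbit indices,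
-- δ (i , w) = (i , π i w). If t ≥ 2 (via an edge to another orbit) or |W| ≥ 3 (three unordered
-- pairs determine their members) δ also keeps local codes; then (v , w) ↦ (v , π (orbit v) w)
-- preserves Γ, so it lies in A ≀ B, and its top component β gives δ = I_t × β. Otherwise t = 1
-- and |W| = 2, so B ≠ I₂ is all of Sym(W) and contains every such δ.
--
-- Colours of Γ need not have decidable equality, so the codes exist only up to double negation,
-- which suffices since the theorem is a negation.

module Submission where

open import Defs
open import Level using (0ℓ)
open import Data.Nat using (ℕ; zero; suc; _≤_; z≤n; s≤s; _⊓_; _⊔_)
import Data.Nat.Properties as ℕ
open import Data.Fin using (Fin; zero; suc; toℕ; punchIn; fromℕ<) renaming (_<_ to _<ᶠ_)
open import Data.Fin.Properties
  using (0≢1+n; toℕ-injective; <-cmp; <-irrefl; <-asym; punchInᵢ≢i; punchIn-injective; sequence; inj⇒≟)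
open import Data.Product using (Σ-syntax; ∃-syntax; ∃₂; _×_; _,_; proj₁; proj₂)
open import Data.Product.Properties using (≡-dec)
open import Data.Empty using (⊥-elim)
open import Data.Maybe using (Maybe; just; nothing)
open import Data.Maybe.Properties using (just-injective)
open import Data.Sum using (_⊎_; inj₁; inj₂)
open import Data.Vec using (Vec; tabulate; lookup)
open import Data.Vec.Properties using (tabulate-cong; lookup∘tabulate)
open import Data.Bool using (if_then_else_)
open import Effect.Monad using (RawMonad)
open import Function using (_↔_; Inverse; Injection; Equivalence; _⇔_; mk⇔; mk↔ₛ′; _∘_; case_of_)
open import Function.Definitions using (Injective)
open import Function.Properties.Inverse using (↔⇒↣)
open import Function.Construct.Symmetry using (↔-sym)
open import Function.Construct.Identity using (↔-id)
open import Relation.Binary.Definitions using (DecidableEquality; tri<; tri≈; tri>)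
open import Relation.Binary.PropositionalEquality
open import Relation.Nullary using (¬_; Dec; yes; no; does)
open import Relation.Nullary.Decidable using (_⊎-dec_; does-⇔; ¬¬-excluded-middle; decidable-stable)
open import Relation.Nullary.Negation using (¬¬-Monad; ¬¬-map)
open import Relation.Unary using (Pred; Decidable)

↔-injective : {X Y : Set} (e : X ↔ Y) → Injective _≡_ _≡_ (Inverse.to e)
↔-injective e = Injection.injective (↔⇒↣ e)

≢-punchIn : {X : Set} {n : ℕ} (e : X ↔ Fin (suc n)) (x : X) (k : Fin n) →
  x ≢ Inverse.from e (punchIn (Inverse.to e x) k)
≢-punchIn e x k x≡y =
  punchInᵢ≢i (Inverse.to e x) k (sym (trans (cong (Inverse.to e) x≡y) (Inverse.strictlyInverseˡ e _)))

module _ {X : Set} {n : ℕ} (e : X ↔ Fin n) where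
  open Inverse e

  ≟-enum : DecidableEquality X
  ≟-enum = inj⇒≟ (↔⇒↣ e)

  ¬¬-∀-enum : {P : X → Set} → (∀ x → ¬ ¬ P x) → ¬ ¬ (∀ x → P x)
  ¬¬-∀-enum {P} ¬¬P = ¬¬-map (λ P∘from x → subst P (strictlyInverseʳ x) (P∘from (to x)))
    (sequence (RawMonad.rawApplicative ¬¬-Monad) (¬¬P ∘ from))

  table : {Y : Set} → (X → Y) → Vec Y n
  table g = tabulate (g ∘ from)

  table-cong : {Y : Set} {g h : X → Y} → (∀ x → g x ≡ h x) → table g ≡ table h
  table-cong g≗h = tabulate-cong (g≗h ∘ from)

  table-injective : {Y : Set} {g h : X → Y} → table g ≡ table h → ∀ x → g x ≡ h x
  table-injective {g = g} {h} eq x = begin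
    g x                         ≡⟨ cong g (strictlyInverseʳ x) ⟨
    g (from (to x))             ≡⟨ lookup∘tabulate (g ∘ from) (to x) ⟨
    lookup (table g) (to x)     ≡⟨ cong (λ v → lookup v (to x)) eq ⟩
    lookup (table h) (to x)     ≡⟨ lookup∘tabulate (h ∘ from) (to x) ⟩
    h (from (to x))             ≡⟨ cong h (strictlyInverseʳ x) ⟩
    h x                         ∎
    where open ≡-Reasoning

  otherThan : 2 ≤ n → (x : X) → ∃[ y ] x ≢ y
  otherThan (s≤s (s≤s _)) x = from (punchIn (to x) zero) , ≢-punchIn e x zero

  twoOthers : 3 ≤ n → (x : X) → ∃₂ λ y z → x ≢ y × x ≢ z × y ≢ z
  twoOthers (s≤s (s≤s (s≤s _))) x =
    from (punchIn (to x) zero) , from (punchIn (to x) (suc zero)) ,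
    ≢-punchIn e x zero , ≢-punchIn e x (suc zero) ,
    λ eq → 0≢1+n (punchIn-injective (to x) zero (suc zero) (↔-injective (↔-sym e) eq))

least : ∀ {n} {P : Pred (Fin n) 0ℓ} → Decidable P → ℕ
least {zero}  P? = zero
least {suc n} P? = if does (P? zero) then zero else suc (least (P? ∘ suc))

least-cong : ∀ {n} {P Q : Pred (Fin n) 0ℓ} (P? : Decidable P) (Q? : Decidable Q) →
  (∀ i → P i ⇔ Q i) → least P? ≡ least Q?
least-cong {zero}  P? Q? P⇔Q = refl
least-cong {suc n} P? Q? P⇔Q = cong₂ (λ b r → if b then zero else suc r)
  (does-⇔ (P⇔Q zero) (P? zero) (Q? zero)) (least-cong (P? ∘ suc) (Q? ∘ suc) (P⇔Q ∘ suc))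

least-witness : ∀ {n} {P : Pred (Fin n) 0ℓ} (P? : Decidable P) (i : Fin n) → P i →
  ∃[ k ] toℕ k ≡ least P? × P k
least-witness P? zero Pi with P? zero
... | yes P₀ = zero , refl , P₀
... | no ¬P₀ = ⊥-elim (¬P₀ Pi)
least-witness P? (suc i) Pi with P? zero
... | yes P₀ = zero , refl , P₀
... | no _ with least-witness (P? ∘ suc) i Pi
...   | k , k≡least , Pk = suc k , cong suc k≡least , Pk

module _ {X Y : Set} {n : ℕ} (e : X ↔ Fin n) (g : X → Y) (_≟ᵍ_ : ∀ x y → Dec (g x ≡ g y)) where
  open Inverse e

  kernelCode : X → ℕ
  kernelCode x = least (λ k → from k ≟ᵍ x)

  kernelCode-correct : ∀ x y → kernelCode x ≡ kernelCode y ⇔ g x ≡ g y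
  kernelCode-correct x y = mk⇔ sound complete
    where
      complete : g x ≡ g y → kernelCode x ≡ kernelCode y
      complete gx≡gy = least-cong (λ k → from k ≟ᵍ x) (λ k → from k ≟ᵍ y)
        λ k → mk⇔ (λ p → trans p gx≡gy) (λ p → trans p (sym gx≡gy))

      canonical : ∀ z → ∃[ k ] toℕ k ≡ kernelCode z × g (from k) ≡ g z
      canonical z = least-witness _ (to z) (cong g (strictlyInverseʳ z))

      sound : kernelCode x ≡ kernelCode y → g x ≡ g y
      sound codes≡ with canonical x | canonical y
      ... | k , k≡ , gk≡gx | k′ , k′≡ , gk′≡gy =
        trans (sym gk≡gx) (trans (cong (g ∘ from) k≡k′) gk′≡gy)
        where
          k≡k′ = toℕ-injective (trans k≡ (trans codes≡ (sym k′≡)))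

¬¬-kernelCode : {X Y : Set} {n : ℕ} → X ↔ Fin n → (g : X → Y) →
  ¬ ¬ (Σ[ c ∈ (X → ℕ) ] ∀ x y → c x ≡ c y ⇔ g x ≡ g y)
¬¬-kernelCode e g = ¬¬-map (λ _≟ᵍ_ → kernelCode e g _≟ᵍ_ , kernelCode-correct e g _≟ᵍ_)
  (¬¬-∀-enum e λ x → ¬¬-∀-enum e λ y → ¬¬-excluded-middle)

Fin≤2-differ⇒≡ : ∀ {n} → n ≤ 2 → (a b c : Fin n) → a ≢ b → a ≢ c → b ≡ c
Fin≤2-differ⇒≡ (s≤s z≤n)       zero       zero       _          a≢b _   = ⊥-elim (a≢b refl)
Fin≤2-differ⇒≡ (s≤s (s≤s z≤n)) zero       zero       _          a≢b _   = ⊥-elim (a≢b refl)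
Fin≤2-differ⇒≡ (s≤s (s≤s z≤n)) zero       (suc zero) zero       _   a≢c = ⊥-elim (a≢c refl)
Fin≤2-differ⇒≡ (s≤s (s≤s z≤n)) zero       (suc zero) (suc zero) _   _   = refl
Fin≤2-differ⇒≡ (s≤s (s≤s z≤n)) (suc zero) zero       zero       _   _   = refl
Fin≤2-differ⇒≡ (s≤s (s≤s z≤n)) (suc zero) zero       (suc zero) _   a≢c = ⊥-elim (a≢c refl)
Fin≤2-differ⇒≡ (s≤s (s≤s z≤n)) (suc zero) (suc zero) _          a≢b _   = ⊥-elim (a≢b refl)

module _ {X : Set} {n : ℕ} (e : X ↔ Fin n) (n≤2 : n ≤ 2) where

  differ⇒≡ : {a b c : X} → a ≢ b → a ≢ c → b ≡ c
  differ⇒≡ a≢b a≢c =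
    ↔-injective e (Fin≤2-differ⇒≡ n≤2 _ _ _ (a≢b ∘ ↔-injective e) (a≢c ∘ ↔-injective e))

  injection≗id⊎≗ : (g h : X → X) → Injective _≡_ _≡_ g → Injective _≡_ _≡_ h →
    (x₀ : X) → h x₀ ≢ x₀ → (∀ x → g x ≡ x) ⊎ (∀ x → g x ≡ h x)
  injection≗id⊎≗ g h g-inj h-inj x₀ hx₀≢x₀ with ≟-enum e (g x₀) x₀
  ... | yes gx₀≡x₀ = inj₁ fixes
    where
      fixes : ∀ x → g x ≡ x
      fixes x with ≟-enum e x x₀
      ... | yes refl = gx₀≡x₀
      ... | no x≢x₀ = differ⇒≡ (λ x₀≡gx → x≢x₀ (g-inj (trans (sym x₀≡gx) (sym gx₀≡x₀)))) (x≢x₀ ∘ sym)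
  ... | no gx₀≢x₀ = inj₂ agrees
    where
      gx₀≡hx₀ : g x₀ ≡ h x₀
      gx₀≡hx₀ = differ⇒≡ (gx₀≢x₀ ∘ sym) (hx₀≢x₀ ∘ sym)

      agrees : ∀ x → g x ≡ h x
      agrees x with ≟-enum e x x₀
      ... | yes refl = gx₀≡hx₀
      ... | no x≢x₀ = differ⇒≡ {g x₀} (λ eq → x≢x₀ (g-inj (sym eq)))
                                       (λ eq → x≢x₀ (h-inj (sym (trans (sym gx₀≡hx₀) eq))))

SamePair : (a b a′ b′ : ℕ) → Set
SamePair a b a′ b′ = a′ ⊓ b′ ≡ a ⊓ b × a′ ⊔ b′ ≡ a ⊔ b

samePair⇒ : ∀ {a b a′ b′} → SamePair a b a′ b′ → (a′ ≡ a × b′ ≡ b) ⊎ (a′ ≡ b × b′ ≡ a)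
samePair⇒ {a} {b} {a′} {b′} (⊓≡ , ⊔≡) with ℕ.≤-total a′ b′ | ℕ.≤-total a b
... | inj₁ a′≤b′ | inj₁ a≤b = inj₁
  ( trans (sym (ℕ.m≤n⇒m⊓n≡m a′≤b′)) (trans ⊓≡ (ℕ.m≤n⇒m⊓n≡m a≤b))
  , trans (sym (ℕ.m≤n⇒m⊔n≡n a′≤b′)) (trans ⊔≡ (ℕ.m≤n⇒m⊔n≡n a≤b)))
... | inj₁ a′≤b′ | inj₂ b≤a = inj₂
  ( trans (sym (ℕ.m≤n⇒m⊓n≡m a′≤b′)) (trans ⊓≡ (ℕ.m≥n⇒m⊓n≡n b≤a))
  , trans (sym (ℕ.m≤n⇒m⊔n≡n a′≤b′)) (trans ⊔≡ (ℕ.m≥n⇒m⊔n≡m b≤a)))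
... | inj₂ b′≤a′ | inj₁ a≤b = inj₂
  ( trans (sym (ℕ.m≥n⇒m⊔n≡m b′≤a′)) (trans ⊔≡ (ℕ.m≤n⇒m⊔n≡n a≤b))
  , trans (sym (ℕ.m≥n⇒m⊓n≡n b′≤a′)) (trans ⊓≡ (ℕ.m≤n⇒m⊓n≡m a≤b)))
... | inj₂ b′≤a′ | inj₂ b≤a = inj₁
  ( trans (sym (ℕ.m≥n⇒m⊔n≡m b′≤a′)) (trans ⊔≡ (ℕ.m≥n⇒m⊔n≡m b≤a))
  , trans (sym (ℕ.m≥n⇒m⊓n≡n b′≤a′)) (trans ⊓≡ (ℕ.m≥n⇒m⊓n≡n b≤a)))

samePair-triangle : ∀ {a b c a′ b′ c′} →
  SamePair a b a′ b′ → SamePair a c a′ c′ → SamePair b c b′ c′ → a′ ≡ a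
samePair-triangle ab ac bc with samePair⇒ ab | samePair⇒ ac | samePair⇒ bc
... | inj₁ (a′≡a , _) | _ | _ = a′≡a
... | inj₂ _ | inj₁ (a′≡a , _) | _ = a′≡a
... | inj₂ (a′≡b , b′≡a) | inj₂ _ | inj₁ (b′≡b , _) = trans a′≡b (trans (sym b′≡b) b′≡a)
... | inj₂ (a′≡b , _) | inj₂ (_ , c′≡a) | inj₂ (_ , c′≡b) = trans a′≡b (trans (sym c′≡b) c′≡a)

module MarkedDiagonal {X : Set} (_≟_ : DecidableEquality X) (Γ : ColoredGraph X) where

  -- Automorphisms preserve Eᵈ on all pairs, not only on distinct ones, so whole
  -- tables of Eᵈ-values can be compared.

  Eᵈ : X → X → Maybe (Color Γ)
  Eᵈ x y with x ≟ y
  ... | yes _ = nothing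
  ... | no _  = just (E Γ x y)

  Eᵈ-sym : ∀ x y → Eᵈ x y ≡ Eᵈ y x
  Eᵈ-sym x y with x ≟ y | y ≟ x
  ... | yes _   | yes _   = refl
  ... | yes x≡y | no y≢x  = ⊥-elim (y≢x (sym x≡y))
  ... | no x≢y  | yes y≡x = ⊥-elim (x≢y (sym y≡x))
  ... | no _    | no _    = cong just (E-sym Γ x y)

  Eᵈ-aut : ∀ {σ} → IsAut Γ σ → ∀ x y → Eᵈ (x · σ) (y · σ) ≡ Eᵈ x y
  Eᵈ-aut {σ} σ-aut x y with x ≟ y | (x · σ) ≟ (y · σ)
  ... | yes _   | yes _     = refl
  ... | yes x≡y | no xσ≢yσ  = ⊥-elim (xσ≢yσ (cong (_· σ) x≡y))
  ... | no x≢y  | yes xσ≡yσ = ⊥-elim (x≢y (↔-injective σ xσ≡yσ))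
  ... | no x≢y  | no _      = cong just (σ-aut x y x≢y)

  Eᵈ-invariant⇒aut : ∀ {σ} → (∀ x y → Eᵈ (x · σ) (y · σ) ≡ Eᵈ x y) → IsAut Γ σ
  Eᵈ-invariant⇒aut {σ} invariant x y x≢y with invariant x y
  ... | eq with x ≟ y | (x · σ) ≟ (y · σ)
  ...   | yes x≡y | _     = ⊥-elim (x≢y x≡y)
  ...   | no _    | yes _ = case eq of λ ()
  ...   | no _    | no _  = just-injective eq

wreathPerm : {X W : Set} → (W → Perm X) → Perm W → Perm (X × W)
wreathPerm {X} {W} α β = mk↔ₛ′ to from to∘from from∘to
  where
    to : X × W → X × W
    to (x , w) = (x · α w , w · β)

    from : X × W → X × W
    from (x , w) = (Inverse.from (α (Inverse.from β w)) x , Inverse.from β w)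

    to∘from : ∀ p → to (from p) ≡ p
    to∘from (x , w) = cong₂ _,_ (Inverse.strictlyInverseˡ (α (Inverse.from β w)) x)
                                (Inverse.strictlyInverseˡ β w)

    from∘to : ∀ p → from (to p) ≡ p
    from∘to (x , w) rewrite Inverse.strictlyInverseʳ β w = cong (_, w) (Inverse.strictlyInverseʳ (α w) x)

fibrePerm : {I X W : Set} (f : X → I) (δ : Perm (I × W)) →
  (∀ p → proj₁ (p · δ) ≡ proj₁ p) → Perm (X × W)
fibrePerm {I} {X} {W} f δ δ-fibre = mk↔ₛ′ to from to∘from from∘to
  where
    open Inverse δ renaming (to to δ→; from to δ←)

    δ←-fibre : ∀ p → proj₁ (δ← p) ≡ proj₁ p
    δ←-fibre p = trans (sym (δ-fibre (δ← p))) (cong proj₁ (strictlyInverseˡ p))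

    to : X × W → X × W
    to (x , w) = (x , proj₂ (δ→ (f x , w)))

    from : X × W → X × W
    from (x , w) = (x , proj₂ (δ← (f x , w)))

    to∘from : ∀ p → to (from p) ≡ p
    to∘from (x , w) = cong (λ q → x , proj₂ q) (begin
      δ→ (f x , proj₂ (δ← (f x , w)))  ≡⟨ cong (δ→ ∘ (_, proj₂ (δ← (f x , w)))) (δ←-fibre (f x , w)) ⟨
      δ→ (δ← (f x , w))                 ≡⟨ strictlyInverseˡ (f x , w) ⟩
      (f x , w)                          ∎)
      where open ≡-Reasoning

    from∘to : ∀ p → from (to p) ≡ p
    from∘to (x , w) = cong (λ q → x , proj₂ q) (begin
      δ← (f x , proj₂ (δ→ (f x , w)))  ≡⟨ cong (δ← ∘ (_, proj₂ (δ→ (f x , w)))) (δ-fibre (f x , w)) ⟨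
      δ← (δ→ (f x , w))                 ≡⟨ strictlyInverseʳ (f x , w) ⟩
      (f x , w)                          ∎)
      where open ≡-Reasoning

Fin≤1-irrelevant : ∀ {n} → n ≤ 1 → (i j : Fin n) → i ≡ j
Fin≤1-irrelevant (s≤s z≤n) zero zero = refl

module WreathGraph (A B : PermGroup) (t : ℕ) (orbits : HasOrbitCount A t)
                   (Γ : ColoredGraph (V A × V B)) (Γ-aut : ∀ σ → Wreath A B σ ⇔ IsAut Γ σ) where

  _≟ʷ_ : DecidableEquality (V B)
  _≟ʷ_ = ≟-enum (enum B)

  open MarkedDiagonal (≡-dec (≟-enum (enum A)) _≟ʷ_) Γ

  orbit : V A → Fin t
  orbit = proj₁ orbits

  rep : Fin t → V A
  rep i = proj₁ (proj₁ (proj₂ orbits) i)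

  orbit-rep : ∀ i → orbit (rep i) ≡ i
  orbit-rep i = proj₂ (proj₁ (proj₂ orbits) i) refl

  wreathPerm-aut : ∀ {α β} → (∀ w → G A (α w)) → G B β → IsAut Γ (wreathPerm α β)
  wreathPerm-aut {α} {β} α∈A β∈B =
    Equivalence.to (Γ-aut (wreathPerm α β)) (α , β , α∈A , β∈B , λ _ _ → refl)

  Eᵈ-B : ∀ {β} → G B β → ∀ v w v′ w′ → Eᵈ (v , w · β) (v′ , w′ · β) ≡ Eᵈ (v , w) (v′ , w′)
  Eᵈ-B {β} β∈B v w v′ w′ =
    Eᵈ-aut {wreathPerm (λ _ → ↔-id (V A)) β} (wreathPerm-aut (λ _ → G-id A) β∈B) (v , w) (v′ , w′)

  onlyAt : V B → Perm (V A) → V B → Perm (V A)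
  onlyAt u α w with w ≟ʷ u
  ... | yes _ = α
  ... | no _  = ↔-id (V A)

  Eᵈ-moveBlock : ∀ {u u′ α} → u ≢ u′ → G A α → ∀ v v′ → Eᵈ (v · α , u) (v′ , u′) ≡ Eᵈ (v , u) (v′ , u′)
  Eᵈ-moveBlock {u} {u′} {α} u≢u′ α∈A v v′ =
    subst₂ (λ α₁ α₂ → Eᵈ (v · α₁ , u) (v′ · α₂ , u′) ≡ Eᵈ (v , u) (v′ , u′)) at-u at-u′
      (Eᵈ-aut {wreathPerm (onlyAt u α) (↔-id (V B))} (wreathPerm-aut onlyAt-∈A (G-id B))
              (v , u) (v′ , u′))
    where
      onlyAt-∈A : ∀ w → G A (onlyAt u α w)
      onlyAt-∈A w with w ≟ʷ u
      ... | yes _ = α∈A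
      ... | no _  = G-id A

      at-u : onlyAt u α u ≡ α
      at-u with u ≟ʷ u
      ... | yes _  = refl
      ... | no u≢u = ⊥-elim (u≢u refl)

      at-u′ : onlyAt u α u′ ≡ ↔-id (V A)
      at-u′ with u′ ≟ʷ u
      ... | yes u′≡u = ⊥-elim (u≢u′ (sym u′≡u))
      ... | no _     = refl

  Eᵈ-toRep : ∀ {u u′ i} → u ≢ u′ → ∀ {v} → orbit v ≡ i → ∀ v′ →
    Eᵈ (v , u) (v′ , u′) ≡ Eᵈ (rep i , u) (v′ , u′)
  Eᵈ-toRep {u} {u′} {i} u≢u′ {v} v∈i v′
    with Equivalence.to (proj₂ (proj₂ orbits) v (rep i)) (trans v∈i (sym (orbit-rep i)))
  ... | α , α∈A , vα≡rep =
    trans (sym (Eᵈ-moveBlock u≢u′ α∈A v v′)) (cong (λ x → Eᵈ (x , u) (v′ , u′)) vα≡rep)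

  Eᵈ-orbit : ∀ {u u′ i j v v′} → u ≢ u′ → orbit v ≡ i → orbit v′ ≡ j →
    Eᵈ (v , u) (v′ , u′) ≡ Eᵈ (rep i , u) (rep j , u′)
  Eᵈ-orbit {u} {u′} {i} {j} {v} {v′} u≢u′ v∈i v′∈j = begin
    Eᵈ (v , u) (v′ , u′)          ≡⟨ Eᵈ-toRep u≢u′ v∈i v′ ⟩
    Eᵈ (rep i , u) (v′ , u′)      ≡⟨ Eᵈ-sym _ _ ⟩
    Eᵈ (v′ , u′) (rep i , u)      ≡⟨ Eᵈ-toRep (u≢u′ ∘ sym) v′∈j (rep i) ⟩
    Eᵈ (rep j , u′) (rep i , u)   ≡⟨ Eᵈ-sym _ _ ⟩
    Eᵈ (rep i , u) (rep j , u′)   ∎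
    where open ≡-Reasoning

  Pattern : Set
  Pattern = Vec (Vec (Maybe (Color Γ)) (size A)) (size A)

  blockPattern : V B → V B → Pattern
  blockPattern w w′ = table (enum A) λ v → table (enum A) λ v′ → Eᵈ (v , w) (v′ , w′)

  blockPattern-B : ∀ {β} → G B β → ∀ w w′ → blockPattern (w · β) (w′ · β) ≡ blockPattern w w′
  blockPattern-B β∈B w w′ = table-cong (enum A) λ v → table-cong (enum A) λ v′ → Eᵈ-B β∈B v w v′ w′

  blockPattern-entry : ∀ {w w′ u u′} → blockPattern w w′ ≡ blockPattern u u′ →
    ∀ v v′ → Eᵈ (v , w) (v′ , w′) ≡ Eᵈ (v , u) (v′ , u′)
  blockPattern-entry eq v v′ = table-injective (enum A) (table-injective (enum A) eq v) v′

  LocalCode : (V B → ℕ) → Set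
  LocalCode code = ∀ w w′ → code w ≡ code w′ ⇔ blockPattern w w ≡ blockPattern w′ w′

  module Quotient (code : V B → ℕ) (code-correct : LocalCode code) where

    data Colour : Set where
      across : (i j : Fin t) (c c′ : ℕ) → Pattern → Colour
      within : (i : Fin t) (c c′ : ℕ) → Maybe (Color Γ) → Colour

    colour : Fin t × V B → Fin t × V B → Colour
    colour (i , w) (j , w′) with <-cmp i j
    ... | tri< _ _ _ = across i j (code w) (code w′) (blockPattern w w′)
    ... | tri≈ _ _ _ = within i (code w ⊓ code w′) (code w ⊔ code w′) (Eᵈ (rep i , w) (rep i , w′))
    ... | tri> _ _ _ = across j i (code w′) (code w) (blockPattern w′ w)

    colour-< : ∀ {i j} → i <ᶠ j → ∀ w w′ →
      colour (i , w) (j , w′) ≡ across i j (code w) (code w′) (blockPattern w w′)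
    colour-< {i} {j} i<j w w′ with <-cmp i j
    ... | tri< _ _ _   = refl
    ... | tri≈ _ i≡j _ = ⊥-elim (<-irrefl i≡j i<j)
    ... | tri> _ _ j<i = ⊥-elim (<-asym i<j j<i)

    colour-> : ∀ {i j} → j <ᶠ i → ∀ w w′ →
      colour (i , w) (j , w′) ≡ across j i (code w′) (code w) (blockPattern w′ w)
    colour-> {i} {j} j<i w w′ with <-cmp i j
    ... | tri< i<j _ _ = ⊥-elim (<-asym i<j j<i)
    ... | tri≈ _ i≡j _ = ⊥-elim (<-irrefl (sym i≡j) j<i)
    ... | tri> _ _ _   = refl

    colour-≡ : ∀ i w w′ → colour (i , w) (i , w′) ≡
      within i (code w ⊓ code w′) (code w ⊔ code w′) (Eᵈ (rep i , w) (rep i , w′))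
    colour-≡ i w w′ with <-cmp i i
    ... | tri< i<i _ _ = ⊥-elim (<-irrefl refl i<i)
    ... | tri≈ _ _ _   = refl
    ... | tri> _ _ i<i = ⊥-elim (<-irrefl refl i<i)

    colour-sym : ∀ x y → colour x y ≡ colour y x
    colour-sym (i , w) (j , w′) with <-cmp i j
    ... | tri< i<j _ _  = sym (colour-> i<j w′ w)
    ... | tri> _ _ j<i  = sym (colour-< j<i w′ w)
    ... | tri≈ _ refl _ = trans
      (cong₂ (λ m e → within i m (code w ⊔ code w′) e) (ℕ.⊓-comm (code w) (code w′)) (Eᵈ-sym _ _))
      (trans (cong (λ M → within i (code w′ ⊓ code w) M _) (ℕ.⊔-comm (code w) (code w′)))
             (sym (colour-≡ i w′ w)))

    Δ : ColoredGraph (Fin t × V B)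
    Δ = record { Color = Colour ; E = colour ; E-sym = colour-sym }

    code-B : ∀ {β} → G B β → ∀ w → code (w · β) ≡ code w
    code-B β∈B w = Equivalence.from (code-correct _ _) (blockPattern-B β∈B w w)

    colour-B : ∀ {β} → G B β → ∀ i w j w′ → colour (i , w · β) (j , w′ · β) ≡ colour (i , w) (j , w′)
    colour-B β∈B i w j w′ with <-cmp i j
    ... | tri< _ _ _ rewrite code-B β∈B w | code-B β∈B w′ | blockPattern-B β∈B w w′ = refl
    ... | tri> _ _ _ rewrite code-B β∈B w | code-B β∈B w′ | blockPattern-B β∈B w′ w = refl
    ... | tri≈ _ _ _ rewrite code-B β∈B w | code-B β∈B w′ | Eᵈ-B β∈B (rep i) w (rep i) w′ = refl

    ParMult⇒aut : ∀ {δ} → ParMult t B δ → IsAut Δ δ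
    ParMult⇒aut (β , β∈B , δ-acts) (i , w) (j , w′) _
      rewrite δ-acts i w | δ-acts j w′ = colour-B β∈B i w j w′

    across-injective : ∀ {i j c₁ c₂ P i′ j′ d₁ d₂ Q} → across i j c₁ c₂ P ≡ across i′ j′ d₁ d₂ Q →
      c₁ ≡ d₁ × c₂ ≡ d₂ × P ≡ Q
    across-injective refl = refl , refl , refl

    within-injective : ∀ {i c₁ c₂ e i′ d₁ d₂ e′} → within i c₁ c₂ e ≡ within i′ d₁ d₂ e′ →
      i ≡ i′ × c₁ ≡ d₁ × c₂ ≡ d₂ × e ≡ e′
    within-injective refl = refl , refl , refl , refl

    within-index : ∀ {x y i c c′ e} → colour x y ≡ within i c c′ e → proj₁ x ≡ i
    within-index {i₁ , w} {j , w′} eq with <-cmp i₁ j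
    ... | tri< _ _ _ = case eq of λ ()
    ... | tri≈ _ _ _ = proj₁ (within-injective eq)
    ... | tri> _ _ _ = case eq of λ ()

    module _ {δ : Perm (Fin t × V B)} (δ-aut : IsAut Δ δ) where

      δ-fibre : ∀ x → proj₁ (x · δ) ≡ proj₁ x
      δ-fibre (i , w) with otherThan (enum B) (two≤ B) w
      ... | w′ , w≢w′ =
        within-index (trans (δ-aut (i , w) (i , w′) (w≢w′ ∘ cong proj₂)) (colour-≡ i w w′))

      π : Fin t → V B → V B
      π i w = proj₂ ((i , w) · δ)

      δ-acts : ∀ i w → (i , w) · δ ≡ (i , π i w)
      δ-acts i w = cong (_, π i w) (δ-fibre (i , w))

      π-injective : ∀ {i w w′} → π i w ≡ π i w′ → w ≡ w′
      π-injective {i} {w} {w′} eq =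
        cong proj₂ (↔-injective δ (trans (δ-acts i w) (trans (cong (i ,_) eq) (sym (δ-acts i w′)))))

      π-colour : ∀ {i w j w′} → (i , w) ≢ (j , w′) →
        colour (i , π i w) (j , π j w′) ≡ colour (i , w) (j , w′)
      π-colour {i} {w} {j} {w′} x≢y =
        trans (sym (cong₂ colour (δ-acts i w) (δ-acts j w′))) (δ-aut (i , w) (j , w′) x≢y)

      π-across : ∀ {i j} → i <ᶠ j → ∀ w w′ →
        code (π i w) ≡ code w × code (π j w′) ≡ code w′ ×
        blockPattern (π i w) (π j w′) ≡ blockPattern w w′
      π-across i<j w w′ = across-injective
        (trans (sym (colour-< i<j _ _)) (trans (π-colour i≢j) (colour-< i<j w w′)))
        where i≢j = λ eq → <-irrefl (cong proj₁ eq) i<j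

      π-within : ∀ i {w w′} → w ≢ w′ →
        SamePair (code w) (code w′) (code (π i w)) (code (π i w′)) ×
        Eᵈ (rep i , π i w) (rep i , π i w′) ≡ Eᵈ (rep i , w) (rep i , w′)
      π-within i {w} {w′} w≢w′ with within-injective
        (trans (sym (colour-≡ i _ _)) (trans (π-colour (w≢w′ ∘ cong proj₂)) (colour-≡ i w w′)))
      ... | _ , ⊓≡ , ⊔≡ , Eᵈ≡ = (⊓≡ , ⊔≡) , Eᵈ≡

      code-π : 3 ≤ size B ⊎ 2 ≤ t → ∀ i w → code (π i w) ≡ code w
      code-π (inj₁ 3≤∣B∣) i w with twoOthers (enum B) 3≤∣B∣ w
      ... | w₁ , w₂ , w≢w₁ , w≢w₂ , w₁≢w₂ = samePair-triangle
        (proj₁ (π-within i w≢w₁)) (proj₁ (π-within i w≢w₂)) (proj₁ (π-within i w₁≢w₂))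
      code-π (inj₂ 2≤t) i w with otherThan (↔-id (Fin t)) 2≤t i
      ... | j , i≢j with <-cmp i j
      ...   | tri< i<j _ _ = proj₁ (π-across i<j w w)
      ...   | tri≈ _ i≡j _ = ⊥-elim (i≢j i≡j)
      ...   | tri> _ _ j<i = proj₁ (proj₂ (π-across j<i w w))

      module _ (rich : 3 ≤ size B ⊎ 2 ≤ t) where

        γ : Perm (V A × V B)
        γ = fibrePerm orbit δ δ-fibre

        γ-across : ∀ {v v′} → orbit v <ᶠ orbit v′ → ∀ w w′ →
          Eᵈ ((v , w) · γ) ((v′ , w′) · γ) ≡ Eᵈ (v , w) (v′ , w′)
        γ-across {v} {v′} lt w w′ = blockPattern-entry (proj₂ (proj₂ (π-across lt w w′))) v v′

        γ-within : ∀ {v v′} → orbit v ≡ orbit v′ → ∀ w w′ →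
          Eᵈ ((v , w) · γ) ((v′ , w′) · γ) ≡ Eᵈ (v , w) (v′ , w′)
        γ-within {v} {v′} same w w′ rewrite sym same with w ≟ʷ w′
        ... | yes refl =
          blockPattern-entry (Equivalence.to (code-correct _ _) (code-π rich (orbit v) w)) v v′
        ... | no w≢w′ = begin
          Eᵈ (v , π i w) (v′ , π i w′)          ≡⟨ Eᵈ-orbit (w≢w′ ∘ π-injective) refl (sym same) ⟩
          Eᵈ (rep i , π i w) (rep i , π i w′)   ≡⟨ proj₂ (π-within i w≢w′) ⟩
          Eᵈ (rep i , w) (rep i , w′)           ≡⟨ Eᵈ-orbit w≢w′ refl (sym same) ⟨
          Eᵈ (v , w) (v′ , w′)                  ∎
          where
            open ≡-Reasoning
            i = orbit v

        γ-aut : IsAut Γ γ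
        γ-aut = Eᵈ-invariant⇒aut {γ} λ { (v , w) (v′ , w′) → γ-Eᵈ v w v′ w′ }
          where
            γ-Eᵈ : ∀ v w v′ w′ → Eᵈ ((v , w) · γ) ((v′ , w′) · γ) ≡ Eᵈ (v , w) (v′ , w′)
            γ-Eᵈ v w v′ w′ with <-cmp (orbit v) (orbit v′)
            ... | tri< lt _ _   = γ-across lt w w′
            ... | tri≈ _ same _ = γ-within same w w′
            ... | tri> _ _ gt   = trans (Eᵈ-sym _ _) (trans (γ-across gt w′ w) (Eᵈ-sym _ _))

        aut⇒ParMult : ParMult t B δ
        aut⇒ParMult with Equivalence.from (Γ-aut γ) γ-aut
        ... | _ , β , _ , β∈B , γ-acts = β , β∈B , λ i w → trans (δ-acts i w) (cong (i ,_) (π-acts i w))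
          where
            π-acts : ∀ i w → π i w ≡ w · β
            π-acts i w = subst (λ k → π k w ≡ w · β) (orbit-rep i) (cong proj₂ (γ-acts (rep i) w))

      acts-uniformly : ∀ {β} → t ≤ 1 → (i₀ : Fin t) → (∀ w → π i₀ w ≡ w · β) →
        ∀ i w → (i , w) · δ ≡ (i , w · β)
      acts-uniformly t≤1 i₀ π≗ i w = trans (δ-acts i w)
        (cong (i ,_) (trans (cong (λ k → π k w) (Fin≤1-irrelevant t≤1 i i₀)) (π≗ w)))

      aut⇒ParMult-twoPoints : (i₀ : Fin t) → t ≤ 1 → size B ≤ 2 →
        ∀ {β w₀} → G B β → w₀ · β ≢ w₀ → ParMult t B δ
      aut⇒ParMult-twoPoints i₀ t≤1 ∣B∣≤2 {β} β∈B moved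
        with injection≗id⊎≗ (enum B) ∣B∣≤2 (π i₀) (_· β) π-injective (↔-injective β) _ moved
      ... | inj₁ π≗id = ↔-id (V B) , G-id B , acts-uniformly {↔-id (V B)} t≤1 i₀ π≗id
      ... | inj₂ π≗β  = β , β∈B , acts-uniformly {β} t≤1 i₀ π≗β

    Δ-InGR : (∀ {δ} → IsAut Δ δ → ParMult t B δ) → InGR (Fin t × V B) (ParMult t B)
    Δ-InGR aut⇒ParMult′ = Δ , λ δ → mk⇔ (ParMult⇒aut {δ}) (aut⇒ParMult′ {δ})

lemma2p6 : (A B : PermGroup) (t : ℕ) → 1 ≤ t → HasOrbitCount A t →
    ¬ InGR (Fin t × V B) (ParMult t B) → ¬ IsI2 B →
    ¬ InGR (V A × V B) (Wreath A B)
lemma2p6 A B t 1≤t orbits Par∉GR B≉I₂ (Γ , Γ-aut) =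
  ¬¬-kernelCode (enum B) (λ w → blockPattern w w) refute
  where
    open WreathGraph A B t orbits Γ Γ-aut

    refute : ¬ (Σ[ code ∈ (V B → ℕ) ] LocalCode code)
    refute (code , code-correct) with (3 ℕ.≤? size B) ⊎-dec (2 ℕ.≤? t)
    ... | yes rich = Par∉GR (Δ-InGR λ {δ} δ-aut → aut⇒ParMult {δ} δ-aut rich)
      where open Quotient code code-correct
    ... | no poor  = B≉I₂ (ℕ.≤-antisym ∣B∣≤2 (two≤ B) , λ β β∈B w →
          decidable-stable ((w · β) ≟ʷ w) λ moved →
            Par∉GR (Δ-InGR λ {δ} δ-aut →
              aut⇒ParMult-twoPoints {δ} δ-aut (fromℕ< 1≤t) t≤1 ∣B∣≤2 β∈B moved))
      where
        open Quotient code code-correct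
        ∣B∣≤2 = ℕ.≤-pred (ℕ.≰⇒> (poor ∘ inj₁))
        t≤1 = ℕ.≤-pred (ℕ.≰⇒> (poor ∘ inj₂))
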